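{- Let $H$ be a finite connected plane multigraph without loops, let $f$ be a quadrangle of $H$, and let $\langle z_0,z_1,z_2,z_3\rangle$ be the facial cycle of $f$. If $z_i=z_{i+2}$ for some $i$ (indices modulo 4), then $z_{i+1}\neq z_{i+3}$, and there is no face $f'\neq f$ of $H$ whose boundary contains both $z_{i+1}$ and $z_{i+3}$.
   Context: $H$ is drawn in the plane without crossings (multiple edges allowed). At each vertex, two edges consecutive in the rotational order of incident edges form an angle; the degree of a face is the number of angles it contains, and a quadrangle is a face of degree 4. The facial cycle of a quadrangle $f$ is a 4-tuple $\langle z_0,z_1,z_2,z_3\rangle$ of vertices on the boundary of $f$ such that for each $i$ there are edges $z_iz_{i+1}$ and $z_iz_{i-1}$ (indices modulo 4) that form an angle in $f$; the $z_i$ need not be distinct. -}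

module Defs where

open import Data.Nat using (ℕ; zero; suc; _+_; _*_; _<_)
open import Data.Fin using (Fin; toℕ)
open import Data.Fin.Properties using (_≟_)
open import Data.Fin.Permutation using (Permutation′; _⟨$⟩ʳ_)
open import Data.List using (List; length; filter; upTo; map)
open import Data.Bool.ListAction using (any; all)
open import Data.List.Base using (allFin)
open import Data.Bool using (Bool; true; false; not; _∧_; T)
open import Data.Bool.Properties using (T?)
open import Data.Product using (Σ; ∃; ∃-syntax; _×_; _,_)
open import Relation.Nullary using (¬_; does)
open import Relation.Binary.PropositionalEquality using (_≡_; _≢_)
open import Data.Nat.Properties using () renaming (_<?_ to _<ℕ?_)

iter : ∀ {A : Set} → (A → A) → ℕ → A → A
iter f zero    x = x
iter f (suc k) x = f (iter f k x)

module _ {n : ℕ} where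

  SameOrbit : (Fin n → Fin n) → Fin n → Fin n → Set
  SameOrbit p d e = ∃[ k ] iter p k d ≡ e

  -- boolean orbit test (orbits of a permutation of Fin n are reached in < n steps)
  inOrbitᵇ : (Fin n → Fin n) → Fin n → Fin n → Bool
  inOrbitᵇ p d e = any (λ k → does (iter p k d ≟ e)) (upTo n)

  isRepᵇ : (Fin n → Fin n) → Fin n → Bool
  isRepᵇ p d = all (λ e → not (does (toℕ e <ℕ? toℕ d) ∧ inOrbitᵇ p d e)) (allFin n)

  numOrbits : (Fin n → Fin n) → ℕ
  numOrbits p = length (filter (λ d → T? (isRepᵇ p d)) (allFin n))

  data Reach (α σ : Fin n → Fin n) (d : Fin n) : Fin n → Set where
    here  : Reach α σ d d
    stepα : ∀ {e} → Reach α σ d e → Reach α σ d (α e)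
    stepσ : ∀ {e} → Reach α σ d e → Reach α σ d (σ e)

-- A finite connected plane multigraph without loops, given as a combinatorial
-- map (rotation system): darts Fin darts, the involution α pairing the two
-- darts of an edge, and σ giving the rotational order of darts around each
-- vertex.  Vertices = σ-orbits, edges = α-orbits, faces = φ-orbits with
-- φ = σ ∘ α.  Planarity (genus 0) is Euler's formula V − E + F = 2, stated
-- as 2V + 2F = #darts + 4 (since #darts = 2E).
record PlaneMultigraph : Set where
  field
    darts : ℕ
    α σ   : Permutation′ darts

  α′ : Fin darts → Fin darts
  α′ d = α ⟨$⟩ʳ d

  σ′ : Fin darts → Fin darts
  σ′ d = σ ⟨$⟩ʳ d

  φ : Fin darts → Fin darts
  φ d = σ′ (α′ d)

  numVertices : ℕ
  numVertices = numOrbits σ′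

  numFaces : ℕ
  numFaces = numOrbits φ

  field
    α-involutive : ∀ d → α′ (α′ d) ≡ d
    α-fixpointFree : ∀ d → α′ d ≢ d
    connected : ∀ d e → Reach α′ σ′ d e
    planar : 2 * numVertices + 2 * numFaces ≡ darts + 4
    loopless : ∀ d → ¬ SameOrbit σ′ d (α′ d)

module _ (H : PlaneMultigraph) where
  open PlaneMultigraph H

  SameVertex : Fin darts → Fin darts → Set
  SameVertex = SameOrbit σ′

  SameFace : Fin darts → Fin darts → Set
  SameFace = SameOrbit φ

  IsQuadrangle : Fin darts → Set
  IsQuadrangle d = iter φ 4 d ≡ d × iter φ 1 d ≢ d × iter φ 2 d ≢ d × iter φ 3 d ≢ d

  -- facial cycle: z_i is the vertex of dart φ^i d (represented by that dart);
  -- indices mod 4 are automatic because φ^4 d = d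
  z : Fin darts → ℕ → Fin darts
  z d i = iter φ i d

  OnBoundary : Fin darts → Fin darts → Set
  OnBoundary e v = ∃[ e′ ] SameFace e e′ × SameVertex e′ v

-- Let u and v be the darts of the quadrangle at the corners z_{i+1} and z_{i+3}, and suppose
-- z_i = z_{i+2}. In the rotation at that vertex, exchange the successors of α u and α v. Composing
-- a permutation with a transposition of two points of one orbit splits that orbit, so the new map
-- has one more vertex and, as the same exchange acts on the faces, one more face. Euler's
-- inequality V − E + F ≤ 2C (by induction over the edges) then forces the new map to be
-- disconnected, and since every old path survives up to the two exchanged corners, u and v lie in
-- different components. A vertex common to u and v, or another face meeting both, is untouched by
-- the exchange and would connect them.

module Submission where

open import Defs
open import Data.Nat using (ℕ; _+_)
open import Data.Fin using (Fin; toℕ)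
open import Data.Product using (∃-syntax; _×_)
open import Relation.Nullary using (¬_)

open import Data.Bool using (Bool; true; false; not; _∧_; _∨_; if_then_else_; T)
open import Data.Bool.ListAction using (and; or)
open import Data.Bool.Properties using (T?; T-≡; T-∧; T-∨; T-not-≡; ∧-identityʳ; ∧-zeroʳ; ∨-identityʳ)
open import Data.Empty using (⊥; ⊥-elim)
open import Data.Fin using (zero; suc)
open import Data.Fin.Permutation.Components using (transpose)
open import Data.Fin.Properties using (_≟_; any?; toℕ-injective; toℕ<n; suc-injective; 0≢1+n; pigeonhole)
open import Data.List using (length; filter; tabulate; upTo; allFin)
open import Data.List.Membership.Propositional using (lose)
open import Data.List.Membership.Propositional.Properties using (∈-upTo⁺; ∈-allFin)
open import Data.List.Properties using (map-cong)
open import Data.List.Relation.Unary.All as All using ()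
open import Data.List.Relation.Unary.All.Properties using (all⁺; all⁻)
open import Data.List.Relation.Unary.Any using (satisfied)
open import Data.List.Relation.Unary.Any.Properties using (any⁺; any⁻)
open import Data.Nat using (zero; suc; _≤_; _<_; _∸_; _*_; z≤n; z<s; s≤s; s≤s⁻¹)
open import Data.Nat.DivMod using (_%_; _/_; m≡m%n+[m/n]*n; m%n<n)
open import Data.Nat.Properties
  using (_<?_; <-cmp; ≤-refl; ≤-reflexive; ≤-trans; ≤-antisym; <⇒≤; <-irrefl; <-≤-trans; ≮⇒≥; <⇒≱;
         n<1+n; m<m+n; m≤m+n; m≤n+m; m<1+n⇒m<n∨m≡n; m≤n⇒m<n∨m≡n; +-comm; +-suc; +-identityʳ; *-suc;
         m∸n+n≡m; ∸-monoʳ-<; +-monoˡ-≤; +-monoʳ-≤; *-monoʳ-≤; +-cancelˡ-≤; module ≤-Reasoning)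
open import Data.Nat.Tactic.RingSolver using (solve-∀)
open import Data.Product using (_,_; proj₁; proj₂)
open import Data.Sum as Sum using (_⊎_; inj₁; inj₂)
open import Function using (_∘_; _⇔_; mk⇔; Equivalence)
open import Function.Bundles using (Injection)
open import Function.Definitions using (Injective)
open import Function.Properties.Inverse using (↔⇒↣)
open import Relation.Binary.Definitions using (Decidable; tri<; tri≈; tri>)
open import Relation.Binary.PropositionalEquality
  using (_≡_; _≢_; refl; sym; trans; cong; cong₂; subst; subst₂; module ≡-Reasoning)
open import Relation.Nullary using (Dec; yes; no; does)
open import Relation.Nullary.Decidable using (_×-dec_; ¬?; map′; dec-true; dec-false; decidable-stable)

iter-+ : ∀ {A : Set} (f : A → A) m n x → iter f (m + n) x ≡ iter f m (iter f n x)
iter-+ f zero    n x = refl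
iter-+ f (suc m) n x = cong f (iter-+ f m n x)

iter-comm : ∀ {A : Set} (f : A → A) m n x → iter f m (iter f n x) ≡ iter f n (iter f m x)
iter-comm f m n x = begin
  iter f m (iter f n x) ≡⟨ iter-+ f m n x ⟨
  iter f (m + n) x      ≡⟨ cong (λ k → iter f k x) (+-comm m n) ⟩
  iter f (n + m) x      ≡⟨ iter-+ f n m x ⟩
  iter f n (iter f m x) ∎
  where open ≡-Reasoning

iter-cong : ∀ {A : Set} {f g : A → A} → (∀ x → f x ≡ g x) → ∀ k x → iter f k x ≡ iter g k x
iter-cong         f≗g zero    x = refl
iter-cong {f = f} f≗g (suc k) x = trans (cong f (iter-cong f≗g k x)) (f≗g _)

iter-periodic : ∀ {A : Set} (f : A → A) {P x} → iter f P x ≡ x → ∀ q → iter f (q * P) x ≡ x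
iter-periodic f         fᴾx≡x zero    = refl
iter-periodic f {P} {x} fᴾx≡x (suc q) = begin
  iter f (P + q * P) x      ≡⟨ iter-+ f P (q * P) x ⟩
  iter f P (iter f (q * P) x) ≡⟨ cong (iter f P) (iter-periodic f fᴾx≡x q) ⟩
  iter f P x                ≡⟨ fᴾx≡x ⟩
  x                         ∎
  where open ≡-Reasoning

least : {P : ℕ → Set} → (∀ k → Dec (P k)) → ∀ k → P k →
        ∃[ m ] (P m × (∀ {i} → i < m → ¬ P i))
least {P} P? k pk = Sum.[ (λ none → ⊥-elim (none (n<1+n k) pk)) , (λ found → found) ]′ (search (suc k))
  where
  search : ∀ k → (∀ {i} → i < k → ¬ P i) ⊎ ∃[ m ] (P m × (∀ {i} → i < m → ¬ P i))
  search zero = inj₁ λ ()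
  search (suc k) with search k | P? k
  ... | inj₂ found | _      = inj₂ found
  ... | inj₁ none  | yes pk = inj₂ (k , pk , none)
  ... | inj₁ none  | no ¬pk = inj₁ λ i<1+k → Sum.[ none , (λ { refl → ¬pk }) ]′ (m<1+n⇒m<n∨m≡n i<1+k)

module _ {n : ℕ} {p : Fin n → Fin n} where

  orbit-refl : ∀ {d} → SameOrbit p d d
  orbit-refl = 0 , refl

  orbit-step : ∀ {d e} → SameOrbit p d e → SameOrbit p d (p e)
  orbit-step (k , refl) = suc k , refl

  orbit-trans : ∀ {d e f} → SameOrbit p d e → SameOrbit p e f → SameOrbit p d f
  orbit-trans {d} (k , refl) (l , refl) = l + k , iter-+ p l k d

  orbit-transfer : ∀ {p′ x y} → (∀ z → SameOrbit p x z → p′ z ≡ p z) →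
                   SameOrbit p x y → SameOrbit p′ x y
  orbit-transfer {p′} {x} agree (k , refl) = k , go k
    where
    go : ∀ k → iter p′ k x ≡ iter p k x
    go zero    = refl
    go (suc k) = trans (cong p′ (go k)) (agree (iter p k x) (k , refl))

T-injective : ∀ {b c} → T b ⇔ T c → b ≡ c
T-injective {false} {false} _ = refl
T-injective {false} {true}  b⇔c = ⊥-elim (Equivalence.from b⇔c _)
T-injective {true}  {false} b⇔c = ⊥-elim (Equivalence.to b⇔c _)
T-injective {true}  {true}  _ = refl

count : ∀ {n} → (Fin n → Bool) → ℕ
count {zero}  P = 0
count {suc n} P = (if P zero then 1 else 0) + count (P ∘ suc)

_without_ : ∀ {n} → (Fin n → Bool) → Fin n → Fin n → Bool
(P without x₀) x = P x ∧ not (does (x ≟ x₀))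

count-cong : ∀ {n} {P Q : Fin n → Bool} → (∀ x → P x ≡ Q x) → count P ≡ count Q
count-cong {zero}          P≗Q = refl
count-cong {suc n} {P} {Q} P≗Q rewrite P≗Q zero = cong (_ +_) (count-cong (P≗Q ∘ suc))

count-true : ∀ {n} → count {n} (λ _ → true) ≡ n
count-true {zero}  = refl
count-true {suc n} = cong suc count-true

count-false : ∀ {n} → count {n} (λ _ → false) ≡ 0
count-false {zero}  = refl
count-false {suc n} = count-false {n}

count-complement : ∀ {n} (P : Fin n → Bool) → count P + count (not ∘ P) ≡ n
count-complement {zero}  P = refl
count-complement {suc n} P with P zero
... | true  = cong suc (count-complement (P ∘ suc))
... | false = trans (+-suc _ _) (cong suc (count-complement (P ∘ suc)))

count-insert : ∀ {n} {P Q : Fin n → Bool} x₀ → (∀ x → x ≢ x₀ → P x ≡ Q x) →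
               ¬ T (P x₀) → T (Q x₀) → count Q ≡ suc (count P)
count-insert {suc n} {P} {Q} zero agree ¬px₀ qx₀ with P zero | Q zero
... | false | true = cong suc (sym (count-cong λ x → agree (suc x) λ ()))
... | true  | _    = ⊥-elim (¬px₀ _)
count-insert {suc n} {P} {Q} (suc x₀) agree ¬px₀ qx₀ rewrite agree zero (λ ()) =
  trans (cong ((if Q zero then 1 else 0) +_) (count-insert x₀ agree′ ¬px₀ qx₀)) (+-suc _ _)
  where
  agree′ : ∀ x → x ≢ x₀ → P (suc x) ≡ Q (suc x)
  agree′ x x≢x₀ = agree (suc x) (x≢x₀ ∘ suc-injective)

count-≤-suc : ∀ {n} {P Q : Fin n → Bool} x₀ → (∀ x → x ≢ x₀ → P x ≡ Q x) → count Q ≤ suc (count P)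
count-≤-suc {suc n} {P} {Q} zero agree
  rewrite count-cong {P = P ∘ suc} {Q ∘ suc} (λ x → agree (suc x) λ ()) with P zero | Q zero
... | _     | false = m≤n+m _ (suc _)
... | _     | true  = s≤s (m≤n+m _ _)
count-≤-suc {suc n} {P} {Q} (suc x₀) agree rewrite agree zero (λ ()) =
  ≤-trans (+-monoʳ-≤ _ (count-≤-suc x₀ (λ x x≢x₀ → agree (suc x) (x≢x₀ ∘ suc-injective))))
          (≤-reflexive (+-suc _ _))

T-≟-refl : ∀ {n} (x : Fin n) → T (does (x ≟ x))
T-≟-refl x rewrite dec-true (x ≟ x) refl = _

count-singleton : ∀ {n} (u : Fin n) → count (λ x → does (x ≟ u)) ≡ 1
count-singleton {n} u =
  trans (count-insert {P = λ _ → false} u (λ x x≢u → sym (dec-false (x ≟ u) x≢u)) (λ ()) (T-≟-refl u))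
        (cong suc (count-false {n}))

count-without : ∀ {n} {P : Fin n → Bool} {x₀} → T (P x₀) → count P ≡ suc (count (P without x₀))
count-without {P = P} {x₀} px₀ = count-insert x₀ agree removed px₀
  where
  agree : ∀ x → x ≢ x₀ → (P without x₀) x ≡ P x
  agree x x≢x₀ rewrite dec-false (x ≟ x₀) x≢x₀ = ∧-identityʳ (P x)
  removed : ¬ T ((P without x₀) x₀)
  removed rewrite dec-true (x₀ ≟ x₀) refl | ∧-zeroʳ (P x₀) = λ ()

T-without : ∀ {n} {P : Fin n → Bool} {x₀ x} → T (P x) → x ≢ x₀ → T ((P without x₀) x)
T-without {x₀ = x₀} {x} px x≢x₀ rewrite dec-false (x ≟ x₀) x≢x₀ = Equivalence.from T-∧ (px , _)

count-injection : ∀ {m n} {P : Fin m → Bool} {Q : Fin n → Bool} (g : Fin m → Fin n) →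
                  (∀ {x y} → T (P x) → T (P y) → g x ≡ g y → x ≡ y) →
                  (∀ {x} → T (P x) → T (Q (g x))) → count P ≤ count Q
count-injection {zero}                g inj maps = z≤n
count-injection {suc m} {P = P} {Q} g inj maps with P zero in eq
... | false = count-injection (g ∘ suc) (λ px py → suc-injective ∘ inj px py) maps
... | true  = begin
  suc (count (P ∘ suc))         ≤⟨ s≤s (count-injection (g ∘ suc) (λ px py → suc-injective ∘ inj px py) maps′) ⟩
  suc (count (Q without g zero)) ≡⟨ count-without {P = Q} (maps p₀) ⟨
  count Q                       ∎
  where
  open ≤-Reasoning
  p₀ : T (P zero)
  p₀ = subst T (sym eq) _
  maps′ : ∀ {x} → T (P (suc x)) → T ((Q without g zero) (g (suc x)))
  maps′ px = T-without {P = Q} (maps px) λ g≡ → 0≢1+n (inj p₀ px (sym g≡))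

count-< : ∀ {n} {P Q : Fin n → Bool} {x₀} → (∀ {x} → T (P x) → T (Q x)) → ¬ T (P x₀) → T (Q x₀) →
          count P < count Q
count-< {P = P} {Q} {x₀} P⊆Q ¬px₀ qx₀ = begin-strict
  count P                   ≤⟨ count-injection {P = P} {Q without x₀} (λ x → x) (λ _ _ eq → eq) into-rest ⟩
  count (Q without x₀)      <⟨ n<1+n _ ⟩
  suc (count (Q without x₀)) ≡⟨ count-without {P = Q} qx₀ ⟨
  count Q                   ∎
  where
  open ≤-Reasoning
  into-rest : ∀ {x} → T (P x) → T ((Q without x₀) x)
  into-rest {x} px = T-without {P = Q} (P⊆Q px) λ { refl → ¬px₀ px }

length-filter-tabulate : ∀ {m n} (P : Fin n → Bool) (f : Fin m → Fin n) →
                         length (filter (λ x → T? (P x)) (tabulate f)) ≡ count (P ∘ f)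
length-filter-tabulate {zero}  P f = refl
length-filter-tabulate {suc m} P f with P (f zero)
... | true  = cong suc (length-filter-tabulate P (f ∘ suc))
... | false = length-filter-tabulate P (f ∘ suc)

numOrbits≡count : ∀ {n} (p : Fin n → Fin n) → numOrbits p ≡ count (isRepᵇ p)
numOrbits≡count {n} p = length-filter-tabulate (isRepᵇ p) (λ x → x)

-- Orbits

module Orbits {n : ℕ} (p : Fin n → Fin n) (p-injective : Injective _≡_ _≡_ p) where

  iter-injective : ∀ k {x y} → iter p k x ≡ iter p k y → x ≡ y
  iter-injective zero    eq = eq
  iter-injective (suc k) eq = iter-injective k (p-injective eq)

  period : ∀ d → ∃[ m ] (suc m ≤ n × iter p (suc m) d ≡ d)
  period d with pigeonhole (n<1+n n) (λ (i : Fin (suc n)) → iter p (toℕ i) d)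
  ... | i , j , i<j , pⁱd≡pʲd = m , m<n , sym (iter-injective (toℕ i) pⁱd≡pᵐ⁺¹⁺ⁱd)
    where
    open ≡-Reasoning
    m = toℕ j ∸ suc (toℕ i)
    m+1+i≡j : suc m + toℕ i ≡ toℕ j
    m+1+i≡j = trans (sym (+-suc m (toℕ i))) (m∸n+n≡m i<j)
    pⁱd≡pᵐ⁺¹⁺ⁱd : iter p (toℕ i) d ≡ iter p (toℕ i) (iter p (suc m) d)
    pⁱd≡pᵐ⁺¹⁺ⁱd = begin
      iter p (toℕ i) d                  ≡⟨ pⁱd≡pʲd ⟩
      iter p (toℕ j) d                  ≡⟨ cong (λ k → iter p k d) m+1+i≡j ⟨
      iter p (suc m + toℕ i) d          ≡⟨ iter-+ p (suc m) (toℕ i) d ⟩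
      iter p (suc m) (iter p (toℕ i) d) ≡⟨ iter-comm p (suc m) (toℕ i) d ⟩
      iter p (toℕ i) (iter p (suc m) d) ∎
    m<n : suc m ≤ n
    m<n = ≤-trans (m≤m+n (suc m) (toℕ i)) (≤-trans (≤-reflexive m+1+i≡j) (s≤s⁻¹ (toℕ<n j)))

  orbit-sym : ∀ {d e} → SameOrbit p d e → SameOrbit p e d
  orbit-sym {d} (k , refl) with period d
  ... | m , _ , pᵐ⁺¹d≡d = k * m , (begin
    iter p (k * m) (iter p k d) ≡⟨ iter-+ p (k * m) k d ⟨
    iter p (k * m + k) d        ≡⟨ cong (λ j → iter p j d) (trans (+-comm (k * m) k) (sym (*-suc k m))) ⟩
    iter p (k * suc m) d        ≡⟨ iter-periodic p pᵐ⁺¹d≡d k ⟩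
    d                           ∎)
    where open ≡-Reasoning

  orbit-bounded : ∀ {d e} → SameOrbit p d e → ∃[ k ] (k < n × iter p k d ≡ e)
  orbit-bounded {d} (k , refl) with period d
  ... | m , m<n , pᵐ⁺¹d≡d = r , ≤-trans (m%n<n k (suc m)) m<n , (begin
    iter p r d                                ≡⟨ cong (iter p r) (iter-periodic p pᵐ⁺¹d≡d (k / suc m)) ⟨
    iter p r (iter p (k / suc m * suc m) d)   ≡⟨ iter-+ p r _ d ⟨
    iter p (r + k / suc m * suc m) d          ≡⟨ cong (λ j → iter p j d) (m≡m%n+[m/n]*n k (suc m)) ⟨
    iter p k d                                ∎)
    where
    open ≡-Reasoning
    r = k % suc m

  T-inOrbit⇔ : ∀ {d e} → T (inOrbitᵇ p d e) ⇔ SameOrbit p d e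
  T-inOrbit⇔ {d} {e} = mk⇔ sound complete
    where
    sound : T (inOrbitᵇ p d e) → SameOrbit p d e
    sound t with satisfied (any⁻ _ (upTo n) t)
    ... | k , pᵏd≟e with iter p k d ≟ e
    ...   | yes pᵏd≡e = k , pᵏd≡e
    complete : SameOrbit p d e → T (inOrbitᵇ p d e)
    complete o with orbit-bounded o
    ... | k , k<n , pᵏd≡e = any⁺ _ (lose (∈-upTo⁺ k<n) (subst T (sym (dec-true (iter p k d ≟ e) pᵏd≡e)) _))

  sameOrbit? : Decidable (SameOrbit p)
  sameOrbit? d e = map′ (Equivalence.to T-inOrbit⇔) (Equivalence.from T-inOrbit⇔) (T? (inOrbitᵇ p d e))

  Rep : Fin n → Set
  Rep d = ∀ e → SameOrbit p d e → toℕ d ≤ toℕ e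

  T-isRep⇔ : ∀ {d} → T (isRepᵇ p d) ⇔ Rep d
  T-isRep⇔ {d} = mk⇔ sound complete
    where
    NoSmallerAt : Fin n → Bool
    NoSmallerAt e = not (does (toℕ e <? toℕ d) ∧ inOrbitᵇ p d e)
    sound : T (isRepᵇ p d) → Rep d
    sound t e o = at (toℕ e <? toℕ d) (All.lookup (all⁺ NoSmallerAt (allFin n) t) (∈-allFin e))
      where
      at : (e<d? : Dec (toℕ e < toℕ d)) → T (not (does e<d? ∧ inOrbitᵇ p d e)) → toℕ d ≤ toℕ e
      at (no  e≮d) _ = ≮⇒≥ e≮d
      at (yes e<d) t′ = ⊥-elim (subst T (Equivalence.to T-not-≡ t′) (Equivalence.from T-inOrbit⇔ o))
    complete : Rep d → T (isRepᵇ p d)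
    complete rep = all⁻ NoSmallerAt {xs = allFin n} (All.tabulate λ {e} _ → at e (toℕ e <? toℕ d))
      where
      at : ∀ e (e<d? : Dec (toℕ e < toℕ d)) → T (not (does e<d? ∧ inOrbitᵇ p d e))
      at e (no  _)   = _
      at e (yes e<d) with inOrbitᵇ p d e in eq
      ... | false = _
      ... | true  = <⇒≱ e<d (rep e (Equivalence.to T-inOrbit⇔ (subst T (sym eq) _)))

  rep? : ∀ d → Dec (Rep d)
  rep? d = map′ (Equivalence.to T-isRep⇔) (Equivalence.from T-isRep⇔) (T? (isRepᵇ p d))

  rep-unique : ∀ {x y} → Rep x → Rep y → SameOrbit p x y → x ≡ y
  rep-unique rep-x rep-y o = toℕ-injective (≤-antisym (rep-x _ o) (rep-y _ (orbit-sym o)))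

  ¬rep⇒smaller : ∀ {d} → ¬ Rep d → ∃[ e ] (SameOrbit p d e × toℕ e < toℕ d)
  ¬rep⇒smaller {d} ¬rep with any? (λ e → sameOrbit? d e ×-dec toℕ e <? toℕ d)
  ... | yes found = found
  ... | no  none  = ⊥-elim (¬rep λ e o → ≮⇒≥ λ e<d → none (e , o , e<d))

  rep-exists : ∀ d → ∃[ m ] (SameOrbit p d m × Rep m)
  rep-exists d = descend (suc (toℕ d)) d ≤-refl
    where
    descend : ∀ k d → toℕ d < k → ∃[ m ] (SameOrbit p d m × Rep m)
    descend (suc k) d d<k with rep? d
    ... | yes rep = d , orbit-refl , rep
    ... | no ¬rep with ¬rep⇒smaller ¬rep
    ...   | e , de , e<d with descend k e (≤-trans e<d (s≤s⁻¹ d<k))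
    ...     | m , em , rep = m , orbit-trans de em , rep

  numOrbits-≤-roots : (roots : Fin n → Bool) → (∀ d → ∃[ r ] (T (roots r) × SameOrbit p r d)) →
                      numOrbits p ≤ count roots
  numOrbits-≤-roots roots covered = begin
    numOrbits p         ≡⟨ numOrbits≡count p ⟩
    count (isRepᵇ p)    ≤⟨ count-injection root root-injective (λ {d} _ → proj₁ (proj₂ (covered d))) ⟩
    count roots         ∎
    where
    open ≤-Reasoning
    root : Fin n → Fin n
    root d = proj₁ (covered d)
    root-injective : ∀ {x y} → T (isRepᵇ p x) → T (isRepᵇ p y) → root x ≡ root y → x ≡ y
    root-injective {x} {y} rep-x rep-y same-root =
      rep-unique (Equivalence.to T-isRep⇔ rep-x) (Equivalence.to T-isRep⇔ rep-y)
        (orbit-trans (orbit-sym (proj₂ (proj₂ (covered x))))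
                     (subst (λ r → SameOrbit p r y) (sym same-root) (proj₂ (proj₂ (covered y)))))

module _ {n : ℕ} where

  inOrbitᵇ-cong : ∀ {p p′ : Fin n → Fin n} → (∀ x → p x ≡ p′ x) → ∀ d e → inOrbitᵇ p d e ≡ inOrbitᵇ p′ d e
  inOrbitᵇ-cong p≗p′ d e =
    cong or (map-cong (λ k → cong (λ x → does (x ≟ e)) (iter-cong p≗p′ k d)) (upTo n))

  numOrbits-cong : ∀ {p p′ : Fin n → Fin n} → (∀ x → p x ≡ p′ x) → numOrbits p ≡ numOrbits p′
  numOrbits-cong {p} {p′} p≗p′ = begin
    numOrbits p       ≡⟨ numOrbits≡count p ⟩
    count (isRepᵇ p)  ≡⟨ count-cong isRepᵇ-cong ⟩
    count (isRepᵇ p′) ≡⟨ numOrbits≡count p′ ⟨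
    numOrbits p′      ∎
    where
    open ≡-Reasoning
    isRepᵇ-cong : ∀ d → isRepᵇ p d ≡ isRepᵇ p′ d
    isRepᵇ-cong d = cong and (map-cong (λ e → cong (λ b → not (does (toℕ e <? toℕ d) ∧ b))
                                                   (inOrbitᵇ-cong p≗p′ d e))
                                       (allFin n))

  numOrbits-id : numOrbits {n} (λ x → x) ≡ n
  numOrbits-id = begin
    numOrbits {n} (λ x → x)        ≡⟨ numOrbits≡count {n} (λ x → x) ⟩
    count {n} (isRepᵇ (λ x → x))   ≡⟨ count-cong (Equivalence.to T-≡ ∘ Equivalence.from T-isRep⇔ ∘ singleton) ⟩
    count {n} (λ _ → true)         ≡⟨ count-true ⟩
    n                          ∎
    where
    open ≡-Reasoning
    open Orbits (λ x → x) (λ eq → eq)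
    iter-id : ∀ k (x : Fin n) → iter (λ x → x) k x ≡ x
    iter-id zero    x = refl
    iter-id (suc k) x = iter-id k x
    singleton : ∀ d → Rep d
    singleton d e (k , refl) = ≤-reflexive (cong toℕ (sym (iter-id k d)))

module _ {n : ℕ} (f : Fin n → Fin n) (f-involutive : ∀ x → f (f x) ≡ x) where

  involutive⇒injective : Injective _≡_ _≡_ f
  involutive⇒injective {x} {y} fx≡fy = trans (sym (f-involutive x)) (trans (cong f fx≡fy) (f-involutive y))

  open Orbits f involutive⇒injective

  involution-orbit : ∀ {x y} → SameOrbit f x y → y ≡ x ⊎ y ≡ f x
  involution-orbit {x} (k , refl) = go k
    where
    go : ∀ k → iter f k x ≡ x ⊎ iter f k x ≡ f x
    go zero = inj₁ refl
    go (suc k) with go k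
    ... | inj₁ fᵏx≡x  = inj₂ (cong f fᵏx≡x)
    ... | inj₂ fᵏx≡fx = inj₁ (trans (cong f fᵏx≡fx) (f-involutive x))

  -- f maps the non-representatives injectively to representatives
  involution-n≤2*numOrbits : n ≤ 2 * numOrbits f
  involution-n≤2*numOrbits = begin
    n                                         ≡⟨ count-complement (isRepᵇ f) ⟨
    count (isRepᵇ f) + count (not ∘ isRepᵇ f) ≤⟨ +-monoʳ-≤ (count (isRepᵇ f)) non-reps≤reps ⟩
    count (isRepᵇ f) + count (isRepᵇ f)       ≡⟨ cong (count (isRepᵇ f) +_) (+-identityʳ _) ⟨
    2 * count (isRepᵇ f)                      ≡⟨ cong (2 *_) (numOrbits≡count f) ⟨
    2 * numOrbits f                           ∎
    where
    open ≤-Reasoning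
    partner-rep : ∀ {x} → ¬ Rep x → Rep (f x)
    partner-rep {x} ¬rep e o with ¬rep⇒smaller ¬rep
    ... | y , xy , y<x with involution-orbit xy | involution-orbit o
    ...   | inj₁ refl | _         = ⊥-elim (<-irrefl refl y<x)
    ...   | inj₂ refl | inj₁ refl = ≤-refl
    ...   | inj₂ refl | inj₂ refl = <⇒≤ (subst (λ z → toℕ (f x) < toℕ z) (sym (f-involutive x)) y<x)
    non-reps≤reps : count (not ∘ isRepᵇ f) ≤ count (isRepᵇ f)
    non-reps≤reps = count-injection f (λ _ _ → involutive⇒injective) λ non-rep →
      Equivalence.from T-isRep⇔ (partner-rep λ rep →
        subst T (Equivalence.to T-not-≡ non-rep) (Equivalence.from T-isRep⇔ rep))

module OneOrbitSplits
  {n : ℕ} {p q : Fin n → Fin n} (p-injective : Injective _≡_ _≡_ p) (q-injective : Injective _≡_ _≡_ q)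
  {a b : Fin n}
  (q⊆p : ∀ {x y} → SameOrbit q x y → SameOrbit p x y)
  (q≡p-outside : ∀ {x y} → ¬ SameOrbit p a x → SameOrbit p x y → SameOrbit q x y)
  (q-covers : ∀ {x} → SameOrbit p a x → SameOrbit q a x ⊎ SameOrbit q b x)
  (a~b : SameOrbit p a b)
  (a≁b : ¬ SameOrbit q a b)
  where

  private
    module P = Orbits p p-injective
    module Q = Orbits q q-injective

    -- the representatives of q are those of p together with m′, the larger of the two new minima
    insert-rep : ∀ {c c′ m m′} → SameOrbit p a c → SameOrbit p a c′ →
                 (∀ {x} → SameOrbit p a x → SameOrbit q c x ⊎ SameOrbit q c′ x) →
                 SameOrbit q c m → Q.Rep m → SameOrbit q c′ m′ → Q.Rep m′ → toℕ m < toℕ m′ →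
                 numOrbits q ≡ suc (numOrbits p)
    insert-rep {c} {c′} {m} {m′} a~c a~c′ covers c~m rep-m c′~m′ rep-m′ m<m′ = begin
      numOrbits q            ≡⟨ numOrbits≡count q ⟩
      count (isRepᵇ q)       ≡⟨ count-insert m′ same-reps ¬p-rep-m′ (Equivalence.from Q.T-isRep⇔ rep-m′) ⟩
      suc (count (isRepᵇ p)) ≡⟨ cong suc (numOrbits≡count p) ⟨
      suc (numOrbits p)      ∎
      where
      open ≡-Reasoning
      a~m : SameOrbit p a m
      a~m = orbit-trans a~c (q⊆p c~m)
      a~m′ : SameOrbit p a m′
      a~m′ = orbit-trans a~c′ (q⊆p c′~m′)
      ¬p-rep-m′ : ¬ T (isRepᵇ p m′)
      ¬p-rep-m′ t = <⇒≱ m<m′ (Equivalence.to P.T-isRep⇔ t m (orbit-trans (P.orbit-sym a~m′) a~m))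
      p-rep-m : P.Rep m
      p-rep-m e m~e with covers (orbit-trans a~m m~e)
      ... | inj₁ c~e  = rep-m e (orbit-trans (Q.orbit-sym c~m) c~e)
      ... | inj₂ c′~e = <⇒≤ (<-≤-trans m<m′ (rep-m′ e (orbit-trans (Q.orbit-sym c′~m′) c′~e)))
      q-rep⇒p-rep : ∀ {x} → x ≢ m′ → Q.Rep x → P.Rep x
      q-rep⇒p-rep {x} x≢m′ rep-x with P.sameOrbit? a x
      ... | no  a≁x = λ e x~e → rep-x e (q≡p-outside a≁x x~e)
      ... | yes a~x with covers a~x
      ...   | inj₁ c~x  = subst P.Rep (sym (Q.rep-unique rep-x rep-m (orbit-trans (Q.orbit-sym c~x) c~m))) p-rep-m
      ...   | inj₂ c′~x = ⊥-elim (x≢m′ (Q.rep-unique rep-x rep-m′ (orbit-trans (Q.orbit-sym c′~x) c′~m′)))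
      same-reps : ∀ x → x ≢ m′ → isRepᵇ p x ≡ isRepᵇ q x
      same-reps x x≢m′ = T-injective (mk⇔
        (λ t → Equivalence.from Q.T-isRep⇔ λ e x~e → Equivalence.to P.T-isRep⇔ t e (q⊆p x~e))
        (λ t → Equivalence.from P.T-isRep⇔ (q-rep⇒p-rep x≢m′ (Equivalence.to Q.T-isRep⇔ t))))

  numOrbits-refine : numOrbits q ≡ suc (numOrbits p)
  numOrbits-refine with Q.rep-exists a | Q.rep-exists b
  ... | m , a~m , rep-m | m′ , b~m′ , rep-m′ with <-cmp (toℕ m) (toℕ m′)
  ... | tri< m<m′ _ _ = insert-rep orbit-refl a~b q-covers a~m rep-m b~m′ rep-m′ m<m′
  ... | tri> _ _ m′<m = insert-rep a~b orbit-refl (Sum.swap ∘ q-covers) b~m′ rep-m′ a~m rep-m m′<m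
  ... | tri≈ _ m≡m′ _ = ⊥-elim (a≁b (orbit-trans a~m
                          (subst (λ z → SameOrbit q z b) (sym (toℕ-injective m≡m′)) (Q.orbit-sym b~m′))))

-- Composing with a transposition

module _ {n : ℕ} where

  transpose-ˡ : (i j : Fin n) → transpose i j i ≡ j
  transpose-ˡ i j rewrite dec-true (i ≟ i) refl = refl

  transpose-ʳ : (i j : Fin n) → transpose i j j ≡ i
  transpose-ʳ i j with j ≟ i
  ... | yes j≡i = j≡i
  ... | no  _   rewrite dec-true (j ≟ j) refl = refl

  transpose-≢ : ∀ {i j k : Fin n} → k ≢ i → k ≢ j → transpose i j k ≡ k
  transpose-≢ {i} {j} {k} k≢i k≢j rewrite dec-false (k ≟ i) k≢i | dec-false (k ≟ j) k≢j = refl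

  transpose-cases : ∀ (i j k : Fin n) → {P : Fin n → Set} →
                    (k ≡ i → P j) → (k ≡ j → P i) → (k ≢ i → k ≢ j → P k) → P (transpose i j k)
  transpose-cases i j k {P} at-i at-j elsewhere = go (k ≟ i) (k ≟ j)
    where
    go : Dec (k ≡ i) → Dec (k ≡ j) → P (transpose i j k)
    go (yes refl) _          = subst P (sym (transpose-ˡ k j)) (at-i refl)
    go (no  k≢i)  (yes refl) = subst P (sym (transpose-ʳ i k)) (at-j refl)
    go (no  k≢i)  (no  k≢j)  = subst P (sym (transpose-≢ k≢i k≢j)) (elsewhere k≢i k≢j)

  transpose-involutive : (i j k : Fin n) → transpose i j (transpose i j k) ≡ k
  transpose-involutive i j k = transpose-cases i j k {λ t → transpose i j t ≡ k}
    (λ k≡i → trans (transpose-ʳ i j) (sym k≡i))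
    (λ k≡j → trans (transpose-ˡ i j) (sym k≡j))
    transpose-≢

  transpose-injective : (i j : Fin n) → Injective _≡_ _≡_ (transpose i j)
  transpose-injective i j {x} {y} eq = begin
    x                                 ≡⟨ transpose-involutive i j x ⟨
    transpose i j (transpose i j x)   ≡⟨ cong (transpose i j) eq ⟩
    transpose i j (transpose i j y)   ≡⟨ transpose-involutive i j y ⟩
    y                                 ∎
    where open ≡-Reasoning

  transpose-conj : ∀ {f : Fin n → Fin n} → Injective _≡_ _≡_ f → ∀ i j k →
                   transpose (f i) (f j) (f k) ≡ f (transpose i j k)
  transpose-conj {f} f-injective i j k = transpose-cases i j k {λ t → transpose (f i) (f j) (f k) ≡ f t}
    (λ { refl → transpose-ˡ (f k) (f j) })
    (λ { refl → transpose-ʳ (f i) (f k) })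
    (λ k≢i k≢j → transpose-≢ (k≢i ∘ f-injective) (k≢j ∘ f-injective))

numOrbits-split : ∀ {n} {p : Fin n → Fin n} → Injective _≡_ _≡_ p → ∀ {a b} → a ≢ b →
                  SameOrbit p a b → numOrbits (p ∘ transpose a b) ≡ suc (numOrbits p)
numOrbits-split {n} {p} p-injective {a} {b} a≢b a~b =
  OneOrbitSplits.numOrbits-refine p-injective q-injective q⊆p q≡p-outside q-covers a~b a≁b
  where
  q : Fin n → Fin n
  q = p ∘ transpose a b
  q-injective : Injective _≡_ _≡_ q
  q-injective = transpose-injective a b ∘ p-injective
  module P = Orbits p p-injective
  module Q = Orbits q q-injective

  q≡p : ∀ {x} → x ≢ a → x ≢ b → q x ≡ p x
  q≡p x≢a x≢b = cong p (transpose-≢ x≢a x≢b)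

  q⊆p : ∀ {x y} → SameOrbit q x y → SameOrbit p x y
  q⊆p {x} (k , refl) = go k
    where
    go : ∀ k → SameOrbit p x (iter q k x)
    go zero    = orbit-refl
    go (suc k) = transpose-cases a b (iter q k x) {λ t → SameOrbit p x (p t)}
      (λ qᵏx≡a → orbit-step (orbit-trans (subst (SameOrbit p x) qᵏx≡a (go k)) a~b))
      (λ qᵏx≡b → orbit-step (orbit-trans (subst (SameOrbit p x) qᵏx≡b (go k)) (P.orbit-sym a~b)))
      (λ _ _ → orbit-step (go k))

  q≡p-outside : ∀ {x y} → ¬ SameOrbit p a x → SameOrbit p x y → SameOrbit q x y
  q≡p-outside a≁x = orbit-transfer λ z x~z →
    q≡p (λ { refl → a≁x (P.orbit-sym x~z) }) (λ { refl → a≁x (orbit-trans a~b (P.orbit-sym x~z)) })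

  q-covers : ∀ {x} → SameOrbit p a x → SameOrbit q a x ⊎ SameOrbit q b x
  q-covers (k , refl) = go k
    where
    go : ∀ k → SameOrbit q a (iter p k a) ⊎ SameOrbit q b (iter p k a)
    go zero = inj₁ orbit-refl
    go (suc k) with iter p k a ≟ a | iter p k a ≟ b
    ... | yes pᵏa≡a | _         = inj₂ (1 , trans (cong p (transpose-ʳ a b)) (cong p (sym pᵏa≡a)))
    ... | no  _     | yes pᵏa≡b = inj₁ (1 , trans (cong p (transpose-ˡ a b)) (cong p (sym pᵏa≡b)))
    ... | no  pᵏa≢a | no  pᵏa≢b = Sum.map extend extend (go k)
      where
      extend : ∀ {c} → SameOrbit q c (iter p k a) → SameOrbit q c (iter p (suc k) a)
      extend c~pᵏa = subst (SameOrbit q _) (q≡p pᵏa≢a pᵏa≢b) (orbit-step c~pᵏa)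

  -- with j least such that pʲ a = b, the q-orbit of b is {p a, …, pʲ a}, which misses a
  a≁b : ¬ SameOrbit q a b
  a≁b a~qb with least (λ k → iter p k a ≟ b) (proj₁ a~b) (proj₂ a~b)
  ... | zero   , a≡b , _       = a≢b a≡b
  ... | suc j′ , pʲa≡b , minimal = a∉B (stays (proj₁ b~qa)) (proj₂ b~qa)
    where
    j = suc j′
    b~qa = Q.orbit-sym a~qb
    B : Fin n → Set
    B x = ∃[ i ] (0 < i × i ≤ j × iter p i a ≡ x)
    a∉B : ∀ {x} → B x → x ≢ a
    a∉B (i , 0<i , i≤j , pⁱa≡x) refl with m≤n⇒m<n∨m≡n i≤j
    ... | inj₂ refl = a≢b (trans (sym pⁱa≡x) pʲa≡b)
    ... | inj₁ i<j  = minimal (∸-monoʳ-< 0<i i≤j) (begin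
      iter p (j ∸ i) a                ≡⟨ cong (iter p (j ∸ i)) pⁱa≡x ⟨
      iter p (j ∸ i) (iter p i a)     ≡⟨ iter-+ p (j ∸ i) i a ⟨
      iter p (j ∸ i + i) a            ≡⟨ cong (λ k → iter p k a) (m∸n+n≡m i≤j) ⟩
      iter p j a                      ≡⟨ pʲa≡b ⟩
      b                               ∎)
      where open ≡-Reasoning
    stays : ∀ k → B (iter q k b)
    stays zero = j , s≤s z≤n , ≤-refl , pʲa≡b
    stays (suc k) with stays k | iter q k b ≟ b
    ... | _ | yes qᵏb≡b = 1 , s≤s z≤n , s≤s z≤n , trans (sym (cong p (transpose-ʳ a b))) (cong q (sym qᵏb≡b))
    ... | (i , 0<i , i≤j , pⁱa≡qᵏb) | no qᵏb≢b with m≤n⇒m<n∨m≡n i≤j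
    ...   | inj₂ refl = ⊥-elim (qᵏb≢b (trans (sym pⁱa≡qᵏb) pʲa≡b))
    ...   | inj₁ i<j  = suc i , s≤s z≤n , i<j ,
      trans (cong p pⁱa≡qᵏb) (sym (q≡p (a∉B (i , 0<i , i≤j , pⁱa≡qᵏb)) qᵏb≢b))

numOrbits-merge : ∀ {n} {p : Fin n → Fin n} → Injective _≡_ _≡_ p → ∀ {a b} → a ≢ b →
                  ¬ SameOrbit p a b → numOrbits p ≡ suc (numOrbits (p ∘ transpose a b))
numOrbits-merge {n} {p} p-injective {a} {b} a≢b a≁b = begin
  numOrbits p                       ≡⟨ numOrbits-cong (λ x → cong p (transpose-involutive a b x)) ⟨
  numOrbits (q ∘ transpose a b)     ≡⟨ numOrbits-split (transpose-injective a b ∘ p-injective) a≢b a~qb ⟩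
  suc (numOrbits q)                 ∎
  where
  open ≡-Reasoning
  q : Fin n → Fin n
  q = p ∘ transpose a b
  -- from a, q first jumps to p b and then follows the p-orbit of b until it returns to b
  a~qb : SameOrbit q a b
  a~qb with Orbits.period p p-injective b
  ... | period , _ , returns with least (λ k → iter p (suc k) b ≟ b) period returns
  ...   | m , pᵐ⁺¹b≡b , minimal = suc m , trans (follows m ≤-refl) pᵐ⁺¹b≡b
    where
    follows : ∀ i → i ≤ m → iter q (suc i) a ≡ iter p (suc i) b
    follows zero    _   = cong p (transpose-ˡ a b)
    follows (suc i) i<m = trans (cong q (follows i (<⇒≤ i<m)))
      (cong p (transpose-≢ (λ pⁱ⁺¹b≡a → a≁b (Orbits.orbit-sym p p-injective (suc i , pⁱ⁺¹b≡a)))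
                           (minimal i<m)))

module _ {n : ℕ} {f π : Fin n → Fin n} where

  reach-trans : ∀ {x y z} → Reach f π x y → Reach f π y z → Reach f π x z
  reach-trans x→y here          = x→y
  reach-trans x→y (stepα y→z) = stepα (reach-trans x→y y→z)
  reach-trans x→y (stepσ y→z) = stepσ (reach-trans x→y y→z)

  reach-swap : ∀ {x y} → Reach f π x y → Reach π f x y
  reach-swap here          = here
  reach-swap (stepα x→y) = stepσ (reach-swap x→y)
  reach-swap (stepσ x→y) = stepα (reach-swap x→y)

  orbitσ⇒reach : ∀ {x y} → SameOrbit π x y → Reach f π x y
  orbitσ⇒reach {x} (k , refl) = go k
    where
    go : ∀ k → Reach f π x (iter π k x)
    go zero    = here
    go (suc k) = stepσ (go k)

  orbitφ⇒reach : ∀ {x y} → SameOrbit (π ∘ f) x y → Reach f π x y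
  orbitφ⇒reach {x} (k , refl) = go k
    where
    go : ∀ k → Reach f π x (iter (π ∘ f) k x)
    go zero    = here
    go (suc k) = stepσ (stepα (go k))

module _ {n : ℕ} {f f′ π : Fin n → Fin n} {s t : Fin n}
         (agree : ∀ e → e ≢ s → e ≢ t → f′ e ≡ f e) where

  -- keep the part of the path after its last f-step at s or t
  reach-detour : ∀ {r d} → Reach f π r d → Reach f′ π r d ⊎ (Reach f′ π (f s) d ⊎ Reach f′ π (f t) d)
  reach-detour here = inj₁ here
  reach-detour (stepσ r→d) = Sum.map stepσ (Sum.map stepσ stepσ) (reach-detour r→d)
  reach-detour {r} (stepα {e} r→e) with e ≟ s | e ≟ t
  ... | yes refl | _        = inj₂ (inj₁ here)
  ... | no  _    | yes refl = inj₂ (inj₂ here)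
  ... | no  e≢s  | no  e≢t  = Sum.map step (Sum.map step step) (reach-detour r→e)
    where
    step : ∀ {x} → Reach f′ π x e → Reach f′ π x (f e)
    step x→e = subst (Reach f′ π _) (agree e e≢s e≢t) (stepα x→e)

  reach-prefix : ∀ {r d} → Reach f π r d → Reach f′ π r d ⊎ (Reach f′ π r s ⊎ Reach f′ π r t)
  reach-prefix here = inj₁ here
  reach-prefix (stepσ r→d) = Sum.map₁ stepσ (reach-prefix r→d)
  reach-prefix {r} (stepα {e} r→e) with reach-prefix r→e
  ... | inj₂ hit = inj₂ hit
  ... | inj₁ r→′e with e ≟ s | e ≟ t
  ...   | yes refl | _        = inj₂ (inj₁ r→′e)
  ...   | no  _    | yes refl = inj₂ (inj₂ r→′e)
  ...   | no  e≢s  | no  e≢t  = inj₁ (subst (Reach f′ π r) (agree e e≢s e≢t) (stepα r→′e))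

-- Euler's inequality

+-suc-middle : ∀ a b c → a + suc b + c ≡ a + b + suc c
+-suc-middle = solve-∀

2+-spread : ∀ a b c → 2 + (a + b + c) ≡ a + suc b + suc c
2+-spread = solve-∀

+-2*-suc : ∀ n k → n + 2 * suc k ≡ 2 + (n + 2 * k)
+-2*-suc = solve-∀

module Euler {n : ℕ} (π : Fin n → Fin n) (π-injective : Injective _≡_ _≡_ π) where

  Covers : (Fin n → Fin n) → (Fin n → Bool) → Set
  Covers f roots = ∀ d → ∃[ r ] (T (roots r) × Reach f π r d)

  -- For π the rotation and f the edge involution this reads V + F + E ≤ n + 2C; as n = 2E for a
  -- fixed-point-free f, it is V − E + F ≤ 2C, C being bounded by the number of roots.
  EulerBound : (Fin n → Fin n) → Set
  EulerBound f = ∀ roots → Covers f roots →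
                 numOrbits π + numOrbits (π ∘ f) + numOrbits f ≤ n + 2 * count roots

  euler-id : ∀ {f} → (∀ x → f x ≡ x) → EulerBound f
  euler-id {f} f≗id roots covers = begin
    numOrbits π + numOrbits (π ∘ f) + numOrbits f ≡⟨ cong₂ (λ c c′ → numOrbits π + c + c′) πf≡π f≡n ⟩
    numOrbits π + numOrbits π + n                  ≡⟨ rearrange (numOrbits π) n ⟩
    n + 2 * numOrbits π                            ≤⟨ +-monoʳ-≤ n (*-monoʳ-≤ 2 π-orbits≤roots) ⟩
    n + 2 * count roots                            ∎
    where
    open ≤-Reasoning
    rearrange : ∀ c n → c + c + n ≡ n + 2 * c
    rearrange = solve-∀
    πf≡π : numOrbits (π ∘ f) ≡ numOrbits π
    πf≡π = numOrbits-cong (cong π ∘ f≗id)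
    f≡n : numOrbits f ≡ n
    f≡n = trans (numOrbits-cong f≗id) numOrbits-id
    π-orbit : ∀ {r d} → Reach f π r d → SameOrbit π r d
    π-orbit here          = orbit-refl
    π-orbit (stepα {e} r→e) = subst (SameOrbit π _) (sym (f≗id e)) (π-orbit r→e)
    π-orbit (stepσ r→e) = orbit-step (π-orbit r→e)
    π-orbits≤roots : numOrbits π ≤ count roots
    π-orbits≤roots = Orbits.numOrbits-≤-roots π π-injective roots
      λ d → let r , root , r→d = covers d in r , root , π-orbit r→d

  addRoot : (Fin n → Bool) → Fin n → Fin n → Bool
  addRoot roots y x = roots x ∨ does (x ≟ y)

  count-addRoot : ∀ roots y → count (addRoot roots y) ≤ suc (count roots)
  count-addRoot roots y = count-≤-suc y λ x x≢y →
    sym (trans (cong (roots x ∨_) (dec-false (x ≟ y) x≢y)) (∨-identityʳ (roots x)))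

  covers-addRoot : ∀ {g roots r x y} → T (roots r) → Reach g π r x →
                   (∀ d → ∃[ r ] (T (roots r) × Reach g π r d) ⊎ (Reach g π x d ⊎ Reach g π y d)) →
                   Covers g (addRoot roots y)
  covers-addRoot {roots = roots} {r} {x} {y} root r→x nearly d with nearly d
  ... | inj₁ (r′ , root′ , r′→d) = r′ , Equivalence.from T-∨ (inj₁ root′) , r′→d
  ... | inj₂ (inj₁ x→d)         = r  , Equivalence.from T-∨ (inj₁ root) , reach-trans r→x x→d
  ... | inj₂ (inj₂ y→d)         = y  , Equivalence.from T-∨ (inj₂ (T-≟-refl y)) , y→d

  movedᵇ : (Fin n → Fin n) → Fin n → Bool
  movedᵇ f x = not (does (f x ≟ x))

  moved : (Fin n → Fin n) → ℕ
  moved f = count (movedᵇ f)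

  -- g is f with the edge {a, f a} removed. Putting it back either splits a face of g, whose two
  -- darts a and b are then already connected, or merges two faces and joins at most two components.
  module Step {f : Fin n → Fin n} (f-involutive : ∀ x → f (f x) ≡ x) {a : Fin n} (fa≢a : f a ≢ a) where

    b : Fin n
    b = f a

    g : Fin n → Fin n
    g = f ∘ transpose a b

    private
      a≢b : a ≢ b
      a≢b = fa≢a ∘ sym

      f-injective : Injective _≡_ _≡_ f
      f-injective = involutive⇒injective f f-involutive

      g≡f : ∀ e → e ≢ a → e ≢ b → g e ≡ f e
      g≡f e e≢a e≢b = cong f (transpose-≢ e≢a e≢b)

      g-fixes-a : g a ≡ a
      g-fixes-a = trans (cong f (transpose-ˡ a b)) (f-involutive a)

      g-fixes-b : g b ≡ b
      g-fixes-b = cong f (transpose-ʳ a b)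

      g∘transpose≗f : ∀ x → g (transpose a b x) ≡ f x
      g∘transpose≗f x = cong f (transpose-involutive a b x)

      fx≢a : ∀ {x} → x ≢ b → f x ≢ a
      fx≢a x≢b fx≡a = x≢b (trans (sym (f-involutive _)) (cong f fx≡a))

      fx≢b : ∀ {x} → x ≢ a → f x ≢ b
      fx≢b x≢a fx≡b = x≢a (f-injective fx≡b)

    g-involutive : ∀ x → g (g x) ≡ x
    g-involutive x = go (x ≟ a) (x ≟ b)
      where
      go : Dec (x ≡ a) → Dec (x ≡ b) → g (g x) ≡ x
      go (yes refl) _          = trans (cong g g-fixes-a) g-fixes-a
      go (no  _)    (yes refl) = trans (cong g g-fixes-b) g-fixes-b
      go (no  x≢a)  (no  x≢b)  = trans (cong g (g≡f x x≢a x≢b))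
                                   (trans (g≡f (f x) (fx≢a x≢b) (fx≢b x≢a)) (f-involutive x))

    g-moves-less : moved g < moved f
    g-moves-less = count-< {x₀ = a} g-moved⇒f-moved a-fixed-by-g a-moved-by-f
      where
      g-moved⇒f-moved : ∀ {x} → T (movedᵇ g x) → T (movedᵇ f x)
      g-moved⇒f-moved {x} = go (x ≟ a) (x ≟ b)
        where
        go : Dec (x ≡ a) → Dec (x ≡ b) → T (movedᵇ g x) → T (movedᵇ f x)
        go (yes refl) _          rewrite dec-true (g x ≟ x) g-fixes-a = λ ()
        go (no  _)    (yes refl) rewrite dec-true (g x ≟ x) g-fixes-b = λ ()
        go (no  x≢a)  (no  x≢b)  rewrite g≡f x x≢a x≢b = λ t → t
      a-fixed-by-g : ¬ T (movedᵇ g a)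
      a-fixed-by-g rewrite dec-true (g a ≟ a) g-fixes-a = λ ()
      a-moved-by-f : T (movedᵇ f a)
      a-moved-by-f rewrite dec-false (f a ≟ a) fa≢a = _

    private
      ψ-injective : Injective _≡_ _≡_ (π ∘ g)
      ψ-injective = involutive⇒injective g g-involutive ∘ π-injective

      numOrbits-g : numOrbits g ≡ suc (numOrbits f)
      numOrbits-g = trans (numOrbits-merge (involutive⇒injective g g-involutive) a≢b g-separates)
                          (cong suc (numOrbits-cong g∘transpose≗f))
        where
        g-separates : ¬ SameOrbit g a b
        g-separates (k , gᵏa≡b) = a≢b (trans (sym (fixed k)) gᵏa≡b)
          where
          fixed : ∀ k → iter g k a ≡ a
          fixed zero    = refl
          fixed (suc k) = trans (cong g (fixed k)) g-fixes-a

      reach-detour-ab : ∀ {r d} → Reach f π r d → Reach g π r d ⊎ (Reach g π a d ⊎ Reach g π b d)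
      reach-detour-ab r→d with reach-detour g≡f r→d
      ... | inj₁ r→′d         = inj₁ r→′d
      ... | inj₂ (inj₁ b→d)  = inj₂ (inj₂ b→d)
      ... | inj₂ (inj₂ fb→d) = inj₂ (inj₁ (subst (λ x → Reach g π x _) (f-involutive a) fb→d))

      nearly-covers : ∀ {roots} → Covers f roots →
                      ∀ d → ∃[ r ] (T (roots r) × Reach g π r d) ⊎ (Reach g π a d ⊎ Reach g π b d)
      nearly-covers covers d with covers d
      ... | r , root , r→d = Sum.map₁ (λ r→′d → r , root , r→′d) (reach-detour-ab r→d)

    private
      V Ff Fg Ef Eg : ℕ
      V  = numOrbits π
      Ff = numOrbits (π ∘ f)
      Fg = numOrbits (π ∘ g)
      Ef = numOrbits f
      Eg = numOrbits g

      bound-face-split : SameOrbit (π ∘ g) a b → EulerBound g → EulerBound f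
      bound-face-split a~b bound-g roots covers with covers a
      ... | r , root , r→a = begin
        V + Ff + Ef       ≡⟨ cong (λ F → V + F + Ef) Ff≡1+Fg ⟩
        V + suc Fg + Ef   ≡⟨ +-suc-middle V Fg Ef ⟩
        V + Fg + suc Ef   ≡⟨ cong (V + Fg +_) numOrbits-g ⟨
        V + Fg + Eg       ≤⟨ bound-g roots covers-g ⟩
        n + 2 * count roots ∎
        where
        open ≤-Reasoning
        Ff≡1+Fg : Ff ≡ suc Fg
        Ff≡1+Fg = trans (numOrbits-cong (sym ∘ cong π ∘ g∘transpose≗f)) (numOrbits-split ψ-injective a≢b a~b)
        a→b : Reach g π a b
        a→b = orbitφ⇒reach a~b
        b→a : Reach g π b a
        b→a = orbitφ⇒reach (Orbits.orbit-sym (π ∘ g) ψ-injective a~b)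
        r→′a : Reach g π r a
        r→′a with reach-prefix g≡f r→a
        ... | inj₁ r→′a        = r→′a
        ... | inj₂ (inj₁ r→′a) = r→′a
        ... | inj₂ (inj₂ r→′b) = reach-trans r→′b b→a
        covers-g : Covers g roots
        covers-g d with nearly-covers covers d
        ... | inj₁ covered     = covered
        ... | inj₂ (inj₁ a→d) = r , root , reach-trans r→′a a→d
        ... | inj₂ (inj₂ b→d) = r , root , reach-trans (reach-trans r→′a a→b) b→d

      bound-face-merge : ¬ SameOrbit (π ∘ g) a b → EulerBound g → EulerBound f
      bound-face-merge a≁b bound-g roots covers with covers a
      ... | r , root , r→a = +-cancelˡ-≤ 2 _ _ (begin
        2 + (V + Ff + Ef)         ≡⟨ 2+-spread V Ff Ef ⟩
        V + suc Ff + suc Ef       ≡⟨ cong₂ (λ F E → V + F + E) Fg≡1+Ff numOrbits-g ⟨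
        V + Fg + Eg               ≤⟨ bound-g (addRoot roots y) covers-g ⟩
        n + 2 * count (addRoot roots y) ≤⟨ +-monoʳ-≤ n (*-monoʳ-≤ 2 (count-addRoot roots y)) ⟩
        n + 2 * suc (count roots) ≡⟨ +-2*-suc n (count roots) ⟩
        2 + (n + 2 * count roots) ∎)
        where
        open ≤-Reasoning
        Fg≡1+Ff : Fg ≡ suc Ff
        Fg≡1+Ff = trans (numOrbits-merge ψ-injective a≢b a≁b) (cong suc (numOrbits-cong (cong π ∘ g∘transpose≗f)))
        -- the root of a reaches a or b without crossing the cut; the other one becomes a new root
        extra : ∃[ y ] Covers g (addRoot roots y)
        extra with reach-prefix g≡f r→a
        ... | inj₁ r→′a        = b , covers-addRoot root r→′a (nearly-covers covers)
        ... | inj₂ (inj₁ r→′a) = b , covers-addRoot root r→′a (nearly-covers covers)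
        ... | inj₂ (inj₂ r→′b) = a , covers-addRoot root r→′b (Sum.map₂ Sum.swap ∘ nearly-covers covers)
        y = proj₁ extra
        covers-g : Covers g (addRoot roots y)
        covers-g = proj₂ extra

    bound : EulerBound g → EulerBound f
    bound with Orbits.sameOrbit? (π ∘ g) ψ-injective a b
    ... | yes a~b = bound-face-split a~b
    ... | no  a≁b = bound-face-merge a≁b

  euler : ∀ {f} → (∀ x → f (f x) ≡ x) → EulerBound f
  euler {f} f-involutive = go (suc (moved f)) f f-involutive ≤-refl
    where
    go : ∀ k f → (∀ x → f (f x) ≡ x) → moved f < k → EulerBound f
    go (suc k) f f-involutive moved<k with any? (λ x → ¬? (f x ≟ x))
    ... | no  none       = euler-id λ x → decidable-stable (f x ≟ x) λ fx≢x → none (x , fx≢x)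
    ... | yes (a , fa≢a) = S.bound (go k S.g S.g-involutive (<-≤-trans S.g-moves-less (s≤s⁻¹ moved<k)))
      where module S = Step {f} f-involutive fa≢a

  euler-connected : ∀ {f} → (∀ x → f (f x) ≡ x) → ∀ u → (∀ d → Reach f π u d) →
                    numOrbits π + numOrbits (π ∘ f) + numOrbits f ≤ n + 2
  euler-connected {f} f-involutive u reach =
    subst (λ k → numOrbits π + numOrbits (π ∘ f) + numOrbits f ≤ n + 2 * k) (count-singleton u)
      (euler f-involutive (λ x → does (x ≟ u)) λ d → u , T-≟-refl u , reach d)

cut-arithmetic : ∀ V F E N → suc V + suc F + E ≤ N + 2 → N ≤ 2 * E → 2 * V + 2 * F ≡ N + 4 → ⊥
cut-arithmetic V F E N euler involution planar = <-irrefl refl (begin-strict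
  2 * N + 4                       <⟨ m<m+n (2 * N + 4) {4} z<s ⟩
  2 * N + 4 + 4                   ≡⟨ regroup N ⟩
  N + 4 + N + 4                   ≤⟨ +-monoˡ-≤ 4 (+-monoʳ-≤ (N + 4) involution) ⟩
  N + 4 + 2 * E + 4               ≡⟨ cong (λ x → x + 2 * E + 4) planar ⟨
  2 * V + 2 * F + 2 * E + 4       ≡⟨ double V F E ⟩
  2 * (suc V + suc F + E)         ≤⟨ *-monoʳ-≤ 2 euler ⟩
  2 * (N + 2)                     ≡⟨ distrib N ⟩
  2 * N + 4                       ∎)
  where
  open ≤-Reasoning
  regroup : ∀ N → 2 * N + 4 + 4 ≡ N + 4 + N + 4
  regroup = solve-∀
  double : ∀ V F E → 2 * V + 2 * F + 2 * E + 4 ≡ 2 * (suc V + suc F + E)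
  double = solve-∀
  distrib : ∀ N → 2 * (N + 2) ≡ 2 * N + 4
  distrib = solve-∀

-- Cutting a plane map at a vertex

module _ (H : PlaneMultigraph) where
  open PlaneMultigraph H

  σ-injective : Injective _≡_ _≡_ σ′
  σ-injective = Injection.injective (↔⇒↣ σ)

  α-injective : Injective _≡_ _≡_ α′
  α-injective = involutive⇒injective α′ α-involutive

  φ-injective : Injective _≡_ _≡_ φ
  φ-injective = α-injective ∘ σ-injective

  -- Exchanging the successors of α u and α v in the rotation at their common vertex splits that
  -- vertex in two, and splits the common face of u and v in two as well.
  module Cut {u v : Fin darts} (u≢v : u ≢ v) (u~v : SameFace H u v)
             (αu~αv : SameVertex H (α′ u) (α′ v)) where

    σ̃ : Fin darts → Fin darts
    σ̃ = σ′ ∘ transpose (α′ u) (α′ v)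

    private
      αu≢αv : α′ u ≢ α′ v
      αu≢αv = u≢v ∘ α-injective

      numVertices-cut : numOrbits σ̃ ≡ suc numVertices
      numVertices-cut = numOrbits-split σ-injective αu≢αv αu~αv

      σ̃∘α≗φ∘transpose : ∀ x → σ̃ (α′ x) ≡ φ (transpose u v x)
      σ̃∘α≗φ∘transpose x = cong σ′ (transpose-conj α-injective u v x)

      numFaces-cut : numOrbits (σ̃ ∘ α′) ≡ suc numFaces
      numFaces-cut = trans (numOrbits-cong σ̃∘α≗φ∘transpose) (numOrbits-split φ-injective u≢v u~v)

      σ̃≡σ : ∀ {z} → z ≢ α′ u → z ≢ α′ v → σ̃ z ≡ σ′ z
      σ̃≡σ z≢αu z≢αv = cong σ′ (transpose-≢ z≢αu z≢αv)

    -- were u and v still connected, the cut map would violate Euler's inequality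
    cut-disconnects : ¬ Reach α′ σ̃ u v
    cut-disconnects u→v = cut-arithmetic numVertices numFaces (numOrbits α′) darts
      (subst₂ (λ V F → V + F + numOrbits α′ ≤ darts + 2) numVertices-cut numFaces-cut
        (Euler.euler-connected σ̃ (transpose-injective (α′ u) (α′ v) ∘ σ-injective) α-involutive u reach))
      (involution-n≤2*numOrbits α′ α-involutive) planar
      where
      φu : Reach α′ σ̃ u (σ′ (α′ v))
      φu = subst (Reach α′ σ̃ u) (cong σ′ (transpose-ˡ (α′ u) (α′ v))) (stepσ (stepα here))
      φv : Reach α′ σ̃ v (σ′ (α′ u))
      φv = subst (Reach α′ σ̃ v) (cong σ′ (transpose-ʳ (α′ u) (α′ v))) (stepσ (stepα here))
      reach : ∀ d → Reach α′ σ̃ u d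
      reach d with reach-detour {f = σ′} {f′ = σ̃} (λ e → σ̃≡σ) (reach-swap (connected u d))
      ... | inj₁ u→d          = reach-swap u→d
      ... | inj₂ (inj₁ φv→d) = reach-trans (reach-trans u→v φv) (reach-swap φv→d)
      ... | inj₂ (inj₂ φu→d) = reach-trans φu (reach-swap φu→d)

    reach-within-vertex : ∀ {x y} → ¬ SameVertex H (α′ u) x → SameVertex H x y → Reach α′ σ̃ x y
    reach-within-vertex {x} αu≁x x~y = orbitσ⇒reach (orbit-transfer agree x~y)
      where
      open Orbits σ′ σ-injective using (orbit-sym)
      agree : ∀ z → SameVertex H x z → σ̃ z ≡ σ′ z
      agree z x~z = σ̃≡σ (λ { refl → αu≁x (orbit-sym x~z) })
                         (λ { refl → αu≁x (orbit-trans αu~αv (orbit-sym x~z)) })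

    reach-within-face : ∀ {x y} → ¬ SameFace H u x → SameFace H x y → Reach α′ σ̃ x y
    reach-within-face {x} u≁x x~y = orbitφ⇒reach (orbit-transfer agree x~y)
      where
      open Orbits φ φ-injective using (orbit-sym)
      agree : ∀ z → SameFace H x z → σ̃ (α′ z) ≡ φ z
      agree z x~z = trans (σ̃∘α≗φ∘transpose z)
        (cong φ (transpose-≢ (λ { refl → u≁x (orbit-sym x~z) })
                             (λ { refl → u≁x (orbit-trans u~v (orbit-sym x~z)) })))

  module Quadrangle {d₀ : Fin darts} (φ⁴d₀≡d₀ : iter φ 4 d₀ ≡ d₀) (φ²d₀≢d₀ : iter φ 2 d₀ ≢ d₀)
                    (d₀~φ²d₀ : SameVertex H d₀ (iter φ 2 d₀)) where

    private
      open Orbits σ′ σ-injective using () renaming (orbit-sym to vertex-sym)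
      open Orbits φ φ-injective using () renaming (orbit-sym to face-sym)

      u v : Fin darts
      u = iter φ 1 d₀
      v = iter φ 3 d₀

      u≢v : u ≢ v
      u≢v φd₀≡φ³d₀ = φ²d₀≢d₀ (sym (φ-injective φd₀≡φ³d₀))

      u~v : SameFace H u v
      u~v = 2 , refl

      -- α u and α v are the darts preceding φ² d₀ and φ⁴ d₀ = d₀ in the rotation
      αu~αv : SameVertex H (α′ u) (α′ v)
      αu~αv = orbit-trans (1 , refl) (orbit-trans (vertex-sym d₀~φ²d₀)
                (subst (λ x → SameVertex H x (α′ v)) φ⁴d₀≡d₀ (vertex-sym (1 , refl))))

      open Cut u≢v u~v αu~αv

      αu≁u : ¬ SameVertex H (α′ u) u
      αu≁u = loopless u ∘ vertex-sym

      αu≁v-vertex : ∀ {x} → SameVertex H x v → ¬ SameVertex H (α′ u) x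
      αu≁v-vertex x~v αu~x = loopless v (vertex-sym (orbit-trans (vertex-sym αu~αv) (orbit-trans αu~x x~v)))

    opposite-vertices-distinct : ¬ SameVertex H u v
    opposite-vertices-distinct = cut-disconnects ∘ reach-within-vertex αu≁u

    no-other-face-at-opposite-vertices :
      ¬ (∃[ e ] (¬ SameFace H d₀ e × OnBoundary H e u × OnBoundary H e v))
    no-other-face-at-opposite-vertices (e , d₀≁e , (e₁ , e~e₁ , e₁~u) , (e₃ , e~e₃ , e₃~v)) =
      cut-disconnects (reach-trans (reach-within-vertex αu≁u (vertex-sym e₁~u))
                        (reach-trans (reach-within-face u≁e₁ (orbit-trans (face-sym e~e₁) e~e₃))
                                     (reach-within-vertex (αu≁v-vertex e₃~v) e₃~v)))
      where
      u≁e₁ : ¬ SameFace H u e₁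
      u≁e₁ u~e₁ = d₀≁e (orbit-trans (1 , refl) (orbit-trans u~e₁ (face-sym e~e₁)))

lemma4 : (H : PlaneMultigraph) (d : Fin (PlaneMultigraph.darts H)) →
    IsQuadrangle H d →
    (i : Fin 4) →
    SameVertex H (z H d (toℕ i)) (z H d (toℕ i + 2)) →
    ¬ SameVertex H (z H d (toℕ i + 1)) (z H d (toℕ i + 3))
    × ¬ (∃[ e ] (¬ SameFace H d e
                 × OnBoundary H e (z H d (toℕ i + 1))
                 × OnBoundary H e (z H d (toℕ i + 3))))
lemma4 H d (φ⁴d≡d , _ , φ²d≢d , _) i d~φ²d =
  subst₂ (λ x y → ¬ SameVertex H x y) (sym (shift 1)) (sym (shift 3)) Q.opposite-vertices-distinct ,
  λ (e , d≁e , e∋u , e∋v) → Q.no-other-face-at-opposite-vertices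
    (e , (λ d₀~e → d≁e (orbit-trans (t , refl) d₀~e)) ,
     subst (OnBoundary H e) (shift 1) e∋u , subst (OnBoundary H e) (shift 3) e∋v)
  where
  open PlaneMultigraph H
  t = toℕ i
  d₀ = iter φ t d
  shift : ∀ k → z H d (t + k) ≡ iter φ k d₀
  shift k = trans (cong (λ m → iter φ m d) (+-comm t k)) (iter-+ φ k t d)
  module Q = Quadrangle H {d₀}
    (trans (iter-comm φ 4 t d) (cong (iter φ t) φ⁴d≡d))
    (λ φ²d₀≡d₀ → φ²d≢d (Orbits.iter-injective φ (φ-injective H) t (trans (iter-comm φ t 2 d) φ²d₀≡d₀)))
    (subst (SameVertex H d₀) (shift 2) d~φ²d)
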